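{- Let $N=(V,E,\tau,\{u_{ij}\})$ be a temporal network with $n=|V|$ nodes, in which every edge has the same static length $\tau$ and every capacity function $u_{ij}$ is piecewise constant; let $s$ be the source, $d$ the sink and $T$ the time horizon. Then there exists a cut function $\phi$ corresponding to a minimum $(s,0)$-$(d,T)$ cut in $\textsc{TEN}(N,T)$ with $\mathrm{crit}(\phi)\subseteq\mathrm{crit}(N)$.
   Context: $[a,b]=\{a,\dots,b\}$. $\textsc{TEN}(N,T)$ is the steady-state flow network with vertex set $V\times[0,T]$, an edge $(i,t)\to(j,t+\tau)$ of capacity $u_{ij}(t)$ whenever $ij\in E$, $i\ne j$, $t,t+\tau\in[0,T]$ and $u_{ij}(t)\ne0$, and an infinite-capacity edge $(i,t)\to(i,t+1)$ for each $i\in V$, $t\in[0,T-1]$; source $(s,0)$, sink $(d,T)$. A cut function is a map $\phi:V\to[0,T+1]$ with $\phi(s)=0$, $\phi(d)=T+1$, representing the $(s,0)$-$(d,T)$ cut whose source side is $\{(i,t):t\ge\phi(i)\}$ (these are exactly the finite-capacity cuts); its cost is the total capacity of edges from the source side to the sink side. $\mathrm{crit}(\phi):=\{\phi(i):i\in V\}$. Let $\mathcal{T}$ be the set of times at which some $u_{ij}$ changes value, together with $0$, $T$ and $T+1$; then $\mathrm{crit}(N):=\{\theta\pm\ell\tau:\theta\in\mathcal{T},\ \ell\in[0,n]\}$.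
   Formalization: The capacity functions $u_{ij}$ take nonnegative rational values rather than nonnegative real ones. -}

module Defs where

open import Data.Nat as ℕ using (ℕ; zero; suc; _+_; _≤ᵇ_; _<ᵇ_)
open import Data.Fin as Fin using (Fin)
open import Data.Bool using (Bool; true; false; if_then_else_; _∧_; not)
open import Data.Rational as ℚ using (ℚ; 0ℚ)
open import Data.Product using (Σ; ∃; _×_; _,_)
open import Data.Sum using (_⊎_)
open import Relation.Nullary using (¬_)
open import Relation.Nullary.Decidable using (⌊_⌋)
open import Relation.Binary.PropositionalEquality using (_≡_)

sumFin : (n : ℕ) → (Fin n → ℚ) → ℚ
sumFin zero    f = 0ℚ
sumFin (suc n) f = f Fin.zero ℚ.+ sumFin n (λ i → f (Fin.suc i))

sumBelow : ℕ → (ℕ → ℚ) → ℚ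
sumBelow zero    f = 0ℚ
sumBelow (suc m) f = sumBelow m f ℚ.+ f m

record TemporalNetwork (n : ℕ) : Set where
  field
    E       : Fin n → Fin n → Bool
    τ       : ℕ
    u       : Fin n → Fin n → ℕ → ℚ
    u-nonneg : ∀ i j t → 0ℚ ℚ.≤ u i j t
open TemporalNetwork public

IsCutFunction : {n : ℕ} (T : ℕ) (s d : Fin n) → (Fin n → ℕ) → Set
IsCutFunction {n} T s d φ =
  (∀ i → φ i ℕ.≤ suc T) × (φ s ≡ 0) × (φ d ≡ suc T)

-- Is the TEN edge (i,t) → (j,t+τ) present and going from the source side
-- {(k,t') : t' ≥ φ k} to the sink side?
crosses : {n : ℕ} → TemporalNetwork n → (T : ℕ) → (Fin n → ℕ) →
          Fin n → Fin n → ℕ → Bool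
crosses N T φ i j t =
  E N i j ∧ not ⌊ i Fin.≟ j ⌋ ∧ (t + τ N ≤ᵇ T) ∧ (φ i ≤ᵇ t) ∧ (t + τ N <ᵇ φ j)

-- Cost of the cut represented by φ in TEN(N,T): total capacity of the
-- edges (i,t) → (j,t+τ), t ∈ [0,T], from the source side to the sink side.
-- (Edges with u_ij(t) = 0 are absent from TEN but contribute 0 anyway;
-- the infinite-capacity holdover edges never cross a cut function's cut.)
cutCost : {n : ℕ} → TemporalNetwork n → (T : ℕ) → (Fin n → ℕ) → ℚ
cutCost {n} N T φ =
  sumFin n λ i → sumFin n λ j → sumBelow (suc T) λ t →
    if crosses N T φ i j t then u N i j t else 0ℚ

IsMinCutFunction : {n : ℕ} → TemporalNetwork n → (T : ℕ) (s d : Fin n) →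
                   (Fin n → ℕ) → Set
IsMinCutFunction {n} N T s d φ =
  IsCutFunction T s d φ ×
  (∀ ψ → IsCutFunction T s d ψ → cutCost N T φ ℚ.≤ cutCost N T ψ)

InChangeTimes : {n : ℕ} → TemporalNetwork n → (T : ℕ) → ℕ → Set
InChangeTimes {n} N T θ =
  (θ ≡ 0) ⊎ (θ ≡ T) ⊎ (θ ≡ suc T) ⊎
  (Σ ℕ λ θ' → (θ ≡ suc θ') × (suc θ' ℕ.≤ T) ×
     Σ (Fin n) λ i → Σ (Fin n) λ j → (E N i j ≡ true) × ¬ (u N i j θ' ≡ u N i j (suc θ')))

-- crit(N) = {θ ± ℓτ : θ ∈ 𝒯, ℓ ∈ [0,n]}, intersected with ℕ
-- (membership of a natural number x).
InCritN : {n : ℕ} → TemporalNetwork n → (T : ℕ) → ℕ → Set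
InCritN {n} N T x =
  Σ ℕ λ θ → Σ ℕ λ ℓ → InChangeTimes N T θ × (ℓ ℕ.≤ n) ×
    ((x ≡ θ + ℓ ℕ.* τ N) ⊎ (x + ℓ ℕ.* τ N ≡ θ))

CritSubset : {n : ℕ} → TemporalNetwork n → (T : ℕ) → (Fin n → ℕ) → Set
CritSubset N T φ = ∀ i → InCritN N T (φ i)

{-# OPTIONS --safe #-}
module Submission where

-- Write the cost of a cut function φ as a sum over arcs ij of u_ij(t) over the window
-- φ(i) ≤ t < φ(j) − τ. Take a minimum cut and a node i. The cut values reachable from φ(i) by
-- steps of ±τ form a ladder of at most n occupied rungs, and no node off the ladder is τ away
-- from a rung. If some rung c has c or c − τ in 𝒯, then φ(i) ∈ crit(N). Otherwise no capacity
-- changes at any time c or c − τ with c a rung, so lowering all ladder nodes by one (φ⁻) and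
-- raising them by one (φ⁺) change the cost by opposite amounts: cost φ⁻ + cost φ⁺ = 2 cost φ.
-- Since cost φ ≤ cost φ⁺, φ⁻ is again a minimum cut, with smaller Σ φ; descending on Σ φ ends
-- in a minimum cut all of whose values are critical.

open import Defs
open import Algebra.Bundles using (CommutativeMonoid)
open import Data.Bool using (Bool; true; false; if_then_else_; _∧_; not)
open import Data.Bool.Properties as Boolₚ using (∧-zeroʳ; ∧-identityʳ; T-≡)
open import Data.Fin as Fin using (Fin; toℕ)
open import Data.Fin.Properties using (any?; toℕ-injective; toℕ<n; injective⇒≤)
open import Data.Nat using (ℕ; zero; suc; pred; _+_; _*_; _∸_; _≤_; _<_; _≤ᵇ_; _<ᵇ_; z≤n; s≤s; NonZero)
open import Data.Nat.Induction using (<-wellFounded)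
open import Data.Nat.Properties
open import Data.Nat.Tactic.RingSolver using (solve-∀)
open import Data.Product using (Σ; ∃; _×_; _,_; proj₁; proj₂)
open import Data.Rational as ℚ using (ℚ; 0ℚ)
import Data.Rational.Properties as ℚₚ
open import Data.Sum using (_⊎_; inj₁; inj₂; [_,_])
open import Data.Vec.Functional using (_∷_)
open import Function using (_∘_; _⇔_; mk⇔; Equivalence)
open import Induction.WellFounded using (Acc; acc)
open import Relation.Binary.Bundles using (TotalPreorder)
open import Relation.Binary.PropositionalEquality hiding ([_])
open import Relation.Nullary using (¬_; Dec; yes; no; does; contradiction)
open import Relation.Nullary.Decidable using (⌊_⌋; dec-true; dec-false; does-⇔; decidable-stable; _×-dec_; ¬?)
open import Relation.Unary using (Pred; Decidable)

open import Algebra.Properties.CommutativeSemigroup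
  (CommutativeMonoid.commutativeSemigroup ℚₚ.+-0-commutativeMonoid) using (interchange)

≤ᵇ-true : ∀ {m n} → m ≤ n → (m ≤ᵇ n) ≡ true
≤ᵇ-true {m} {n} = dec-true (m ≤? n)

≤ᵇ-false : ∀ {m n} → ¬ m ≤ n → (m ≤ᵇ n) ≡ false
≤ᵇ-false {m} {n} = dec-false (m ≤? n)

<ᵇ-true : ∀ {m n} → m < n → (m <ᵇ n) ≡ true
<ᵇ-true {m} {n} = dec-true (m <? n)

<ᵇ-false : ∀ {m n} → ¬ m < n → (m <ᵇ n) ≡ false
<ᵇ-false {m} {n} = dec-false (m <? n)

≤ᵇ-sound : ∀ {m n} → (m ≤ᵇ n) ≡ true → m ≤ n
≤ᵇ-sound {m} {n} eq = ≤ᵇ⇒≤ m n (Equivalence.from T-≡ eq)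

≤ᵇ-cong : ∀ {m n m′ n′} → m ≤ n ⇔ m′ ≤ n′ → (m ≤ᵇ n) ≡ (m′ ≤ᵇ n′)
≤ᵇ-cong {m} {n} {m′} {n′} m≤n⇔m′≤n′ = does-⇔ m≤n⇔m′≤n′ (m ≤? n) (m′ ≤? n′)

≤⇔<-if-≢ : ∀ {m n} → m ≢ n → m ≤ n ⇔ m < n
≤⇔<-if-≢ m≢n = mk⇔ (λ m≤n → ≤∧≢⇒< m≤n m≢n) <⇒≤

<-suc⇔<-if-≢ : ∀ {m n} → m ≢ n → m < suc n ⇔ m < n
<-suc⇔<-if-≢ m≢n = mk⇔ (λ m<1+n → ≤∧≢⇒< (≤-pred m<1+n) m≢n) m<n⇒m<1+n

if-cong : ∀ {A : Set} {c c′ : Bool} {x y z : A} → c ≡ c′ → (c ≡ true → x ≡ y) →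
          (if c then x else z) ≡ (if c′ then y else z)
if-cong {c = false} refl _   = refl
if-cong {c = true}  refl x≡y = x≡y refl

if-≤ : ∀ b {x y B} → x ≤ B → y ≤ B → (if b then x else y) ≤ B
if-≤ false _   y≤B = y≤B
if-≤ true  x≤B _   = x≤B

leastFailure : ∀ {p} {P : Pred ℕ p} → Decidable P → ∀ F → ¬ P F →
               ∃ λ r → (∀ {m} → m < r → P m) × ¬ P r
leastFailure P? zero ¬P0 = 0 , (λ ()) , ¬P0
leastFailure P? (suc F) ¬P[1+F] with P? 0
... | no ¬P0 = 0 , (λ ()) , ¬P0
... | yes P0 with leastFailure (P? ∘ suc) F ¬P[1+F]
...   | r , holds , ¬Pr = suc r , (λ { {zero} _ → P0 ; {suc m} m<1+r → holds (≤-pred m<1+r) }) , ¬Pr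

x+[1+m]τ≡x+mτ+τ : ∀ x m τ → x + suc m * τ ≡ x + m * τ + τ
x+[1+m]τ≡x+mτ+τ = solve-∀

x+[m+k]τ≡x+mτ+kτ : ∀ x m k τ → x + (m + k) * τ ≡ x + m * τ + k * τ
x+[m+k]τ≡x+mτ+kτ = solve-∀

cancel-multiples : ∀ a θ X Y τ → a + X * τ ≡ θ + Y * τ →
                   (∃ λ d → d ≤ X × a + d * τ ≡ θ) ⊎ (∃ λ d → d ≤ Y × a ≡ θ + d * τ)
cancel-multiples a θ X       zero    τ eq = inj₁ (X , ≤-refl , trans eq (+-identityʳ θ))
cancel-multiples a θ zero    (suc Y) τ eq = inj₂ (suc Y , ≤-refl , trans (sym (+-identityʳ a)) eq)
cancel-multiples a θ (suc X) (suc Y) τ eq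
  with cancel-multiples a θ X Y τ
         (+-cancelʳ-≡ τ _ _ (trans (sym (x+[1+m]τ≡x+mτ+τ a X τ)) (trans eq (x+[1+m]τ≡x+mτ+τ θ Y τ))))
... | inj₁ (d , d≤X , e) = inj₁ (d , m≤n⇒m≤1+n d≤X , e)
... | inj₂ (d , d≤Y , e) = inj₂ (d , m≤n⇒m≤1+n d≤Y , e)

progression-shift : ∀ {a c bottom p q θ ℓ τ} → a ≡ bottom + p * τ → c ≡ bottom + q * τ → c ≡ θ + ℓ * τ →
                    a + q * τ ≡ θ + (ℓ + p) * τ
progression-shift {bottom = bottom} {p} {q} {θ} {ℓ} {τ} refl refl c≡θ+ℓτ = begin
  bottom + p * τ + q * τ   ≡⟨ x+[m+k]τ≡x+mτ+kτ bottom p q τ ⟨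
  bottom + (p + q) * τ     ≡⟨ cong (λ m → bottom + m * τ) (+-comm p q) ⟩
  bottom + (q + p) * τ     ≡⟨ x+[m+k]τ≡x+mτ+kτ bottom q p τ ⟩
  bottom + q * τ + p * τ   ≡⟨ cong (_+ p * τ) c≡θ+ℓτ ⟩
  θ + ℓ * τ + p * τ        ≡⟨ x+[m+k]τ≡x+mτ+kτ θ ℓ p τ ⟨
  θ + (ℓ + p) * τ          ∎
  where open ≡-Reasoning

∀⊎-const : ∀ {n} {A : Fin n → Set} {B : Set} → (∀ k → A k ⊎ B) → (∀ k → A k) ⊎ B
∀⊎-const {zero}  f = inj₁ λ ()
∀⊎-const {suc n} f with f Fin.zero | ∀⊎-const (f ∘ Fin.suc)
... | inj₂ b | _       = inj₂ b
... | inj₁ _ | inj₂ b  = inj₂ b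
... | inj₁ a | inj₁ as = inj₁ λ { Fin.zero → a ; (Fin.suc k) → as k }

sumℕ : ∀ {n} → (Fin n → ℕ) → ℕ
sumℕ {zero}  f = 0
sumℕ {suc n} f = f Fin.zero + sumℕ (f ∘ Fin.suc)

sumℕ-mono-≤ : ∀ {n} {f g : Fin n → ℕ} → (∀ k → f k ≤ g k) → sumℕ f ≤ sumℕ g
sumℕ-mono-≤ {zero}  f≤g = z≤n
sumℕ-mono-≤ {suc n} f≤g = +-mono-≤ (f≤g Fin.zero) (sumℕ-mono-≤ (f≤g ∘ Fin.suc))

sumℕ-mono-< : ∀ {n} {f g : Fin n → ℕ} → (∀ k → f k ≤ g k) → ∀ i → f i < g i → sumℕ f < sumℕ g
sumℕ-mono-< f≤g Fin.zero    fi<gi = +-mono-<-≤ fi<gi (sumℕ-mono-≤ (f≤g ∘ Fin.suc))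
sumℕ-mono-< f≤g (Fin.suc i) fi<gi = +-mono-≤-< (f≤g Fin.zero) (sumℕ-mono-< (f≤g ∘ Fin.suc) i fi<gi)

sumBelow-cong : ∀ m {f g : ℕ → ℚ} → (∀ t → f t ≡ g t) → sumBelow m f ≡ sumBelow m g
sumBelow-cong zero    f≗g = refl
sumBelow-cong (suc m) f≗g = cong₂ ℚ._+_ (sumBelow-cong m f≗g) (f≗g m)

sumBelow-zero : ∀ m → sumBelow m (λ _ → 0ℚ) ≡ 0ℚ
sumBelow-zero zero    = refl
sumBelow-zero (suc m) = trans (ℚₚ.+-identityʳ _) (sumBelow-zero m)

sumBelow-+ : ∀ m (f g : ℕ → ℚ) → sumBelow m (λ t → f t ℚ.+ g t) ≡ sumBelow m f ℚ.+ sumBelow m g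
sumBelow-+ zero    f g = sym (ℚₚ.+-identityʳ 0ℚ)
sumBelow-+ (suc m) f g =
  trans (cong (ℚ._+ (f m ℚ.+ g m)) (sumBelow-+ m f g)) (interchange (sumBelow m f) (sumBelow m g) (f m) (g m))

point : ℕ → ℚ → ℕ → ℚ
point c x t = if does (t ≟ c) then x else 0ℚ

point-on : ∀ c x → point c x c ≡ x
point-on c x = cong (λ b → if b then x else 0ℚ) (dec-true (c ≟ c) refl)

point-off : ∀ {c t} x → t ≢ c → point c x t ≡ 0ℚ
point-off {c} {t} x t≢c = cong (λ b → if b then x else 0ℚ) (dec-false (t ≟ c) t≢c)

sumBelow-point-beyond : ∀ {m c} x → m ≤ c → sumBelow m (point c x) ≡ 0ℚ
sumBelow-point-beyond {zero}  x _   = refl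
sumBelow-point-beyond {suc m} x m<c =
  trans (cong₂ ℚ._+_ (sumBelow-point-beyond x (<⇒≤ m<c)) (point-off x (<⇒≢ m<c))) (ℚₚ.+-identityʳ 0ℚ)

sumBelow-point : ∀ {m c} x → c < m → sumBelow m (point c x) ≡ x
sumBelow-point {suc m} {c} x c<1+m with m ≟ c
... | yes refl = trans (cong₂ ℚ._+_ (sumBelow-point-beyond {m} x ≤-refl) (point-on m x)) (ℚₚ.+-identityˡ x)
... | no m≢c   = trans (cong₂ ℚ._+_ (sumBelow-point x (≤∧≢⇒< (≤-pred c<1+m) (m≢c ∘ sym))) (point-off x m≢c))
                       (ℚₚ.+-identityʳ x)

sumFin-cong : ∀ n {f g : Fin n → ℚ} → (∀ i → f i ≡ g i) → sumFin n f ≡ sumFin n g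
sumFin-cong zero    f≗g = refl
sumFin-cong (suc n) f≗g = cong₂ ℚ._+_ (f≗g Fin.zero) (sumFin-cong n (f≗g ∘ Fin.suc))

sumFin-+ : ∀ n (f g : Fin n → ℚ) → sumFin n (λ i → f i ℚ.+ g i) ≡ sumFin n f ℚ.+ sumFin n g
sumFin-+ zero    f g = sym (ℚₚ.+-identityʳ 0ℚ)
sumFin-+ (suc n) f g =
  trans (cong (f Fin.zero ℚ.+ g Fin.zero ℚ.+_) (sumFin-+ n (f ∘ Fin.suc) (g ∘ Fin.suc)))
        (interchange (f Fin.zero) (g Fin.zero) (sumFin n (f ∘ Fin.suc)) (sumFin n (g ∘ Fin.suc)))

sumFin-balanced : ∀ n {f g h : Fin n → ℚ} → (∀ i → f i ℚ.+ g i ≡ h i ℚ.+ h i) →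
                  sumFin n f ℚ.+ sumFin n g ≡ sumFin n h ℚ.+ sumFin n h
sumFin-balanced n {f} {g} {h} balanced =
  trans (sym (sumFin-+ n f g)) (trans (sumFin-cong n balanced) (sumFin-+ n h h))

-- p − q = z − w = q − r, stated without subtraction.
progression-midpoint : ∀ {p q r} x y z w → p ≡ x ℚ.+ z → r ≡ y ℚ.+ w → q ≡ x ℚ.+ w → q ≡ y ℚ.+ z →
                       p ℚ.+ r ≡ q ℚ.+ q
progression-midpoint {q = q} x y z w refl refl q≡x+w q≡y+z = begin
  (x ℚ.+ z) ℚ.+ (y ℚ.+ w) ≡⟨ interchange x z y w ⟩
  (x ℚ.+ y) ℚ.+ (z ℚ.+ w) ≡⟨ cong (x ℚ.+ y ℚ.+_) (ℚₚ.+-comm z w) ⟩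
  (x ℚ.+ y) ℚ.+ (w ℚ.+ z) ≡⟨ interchange x y w z ⟩
  (x ℚ.+ w) ℚ.+ (y ℚ.+ z) ≡⟨ cong₂ ℚ._+_ (sym q≡x+w) (sym q≡y+z) ⟩
  q ℚ.+ q                 ∎
  where open ≡-Reasoning

balanced⇒≤ : ∀ {x y z} → y ℚ.+ z ≡ x ℚ.+ x → x ℚ.≤ z → y ℚ.≤ x
balanced⇒≤ y+z≡x+x x≤z = ℚₚ.≮⇒≥ λ x<y → ℚₚ.<-irrefl (sym y+z≡x+x) (ℚₚ.+-mono-<-≤ x<y x≤z)

module Minimiser {c ℓ₁ ℓ₂} (O : TotalPreorder c ℓ₁ ℓ₂) where
  open TotalPreorder O using (Carrier; _≈_; _≲_; total)
    renaming (refl to ≲-refl; trans to ≲-trans; reflexive to ≲-reflexive)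

  argmin-≤ : ∀ B (g : ℕ → Carrier) → ∃ λ v → v ≤ B × (∀ w → w ≤ B → g v ≲ g w)
  argmin-≤ zero    g = 0 , z≤n , λ { zero _ → ≲-refl }
  argmin-≤ (suc B) g with argmin-≤ B g
  ... | v , v≤B , min with total (g v) (g (suc B))
  ...   | inj₁ gv≲ = v , m≤n⇒m≤1+n v≤B ,
          λ w w≤1+B → [ (λ w<1+B → min w (≤-pred w<1+B)) , (λ { refl → gv≲ }) ] (m≤n⇒m<n∨m≡n w≤1+B)
  ...   | inj₂ g≲gv = suc B , ≤-refl ,
          λ w w≤1+B → [ (λ w<1+B → ≲-trans g≲gv (min w (≤-pred w<1+B))) , (λ { refl → ≲-refl }) ]
                        (m≤n⇒m<n∨m≡n w≤1+B)

  argmin : ∀ n B (C : (Fin n → ℕ) → Carrier) → (∀ {f g} → (∀ i → f i ≡ g i) → C f ≈ C g) →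
           ∃ λ f → (∀ i → f i ≤ B) × (∀ g → (∀ i → g i ≤ B) → C f ≲ C g)
  argmin zero    B C ext = (λ ()) , (λ ()) , λ g _ → ≲-reflexive (ext λ ())
  argmin (suc n) B C ext = extend (argmin-≤ B λ v → C (v ∷ rest v))
    where
    restMin : ∀ v → ∃ λ f → (∀ i → f i ≤ B) × (∀ g → (∀ i → g i ≤ B) → C (v ∷ f) ≲ C (v ∷ g))
    restMin v = argmin n B (λ f → C (v ∷ f)) (λ f≗g → ext λ { Fin.zero → refl ; (Fin.suc i) → f≗g i })
    rest : ℕ → Fin n → ℕ
    rest v = proj₁ (restMin v)
    extend : (∃ λ v → v ≤ B × (∀ w → w ≤ B → C (v ∷ rest v) ≲ C (w ∷ rest w))) →
             ∃ λ f → (∀ i → f i ≤ B) × (∀ g → (∀ i → g i ≤ B) → C f ≲ C g)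
    extend (v , v≤B , v-minimal) = (v ∷ rest v) , bounded , minimal
      where
      bounded : ∀ i → (v ∷ rest v) i ≤ B
      bounded Fin.zero    = v≤B
      bounded (Fin.suc i) = proj₁ (proj₂ (restMin v)) i
      minimal : ∀ g → (∀ i → g i ≤ B) → C (v ∷ rest v) ≲ C g
      minimal g g≤B = ≲-trans (v-minimal (g Fin.zero) (g≤B Fin.zero))
        (≲-trans (proj₂ (proj₂ (restMin (g Fin.zero))) (g ∘ Fin.suc) (g≤B ∘ Fin.suc))
                 (≲-reflexive (ext λ { Fin.zero → refl ; (Fin.suc i) → refl })))

-- Steadiness at p (departures) and at p − τ (arrivals) is what makes moving the cut value
-- p + 1 one step down or up change the cost of every arc by opposite amounts.
data Shiftable (Steady : ℕ → Set) (τ T : ℕ) : ℕ → Set where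
  shiftable : ∀ {p} → suc p ≤ T → Steady p → (∀ e → p ≡ e + τ → Steady e) → Shiftable Steady τ T (suc p)

Shiftable-map : ∀ {S S′ : ℕ → Set} {τ T c} → (∀ {x} → S x → S′ x) → Shiftable S τ T c → Shiftable S′ τ T c
Shiftable-map f (shiftable 1+p≤T departures arrivals) =
  shiftable 1+p≤T (f departures) (λ e p≡e+τ → f (arrivals e p≡e+τ))

Shiftable⇒≤ : ∀ {S τ T c} → Shiftable S τ T c → c ≤ T
Shiftable⇒≤ (shiftable 1+p≤T _ _) = 1+p≤T

Shiftable⇒pred< : ∀ {S τ T c} → Shiftable S τ T c → pred c < c
Shiftable⇒pred< (shiftable _ _ _) = ≤-refl

lower raise : Bool → ℕ → ℕ
lower k a = if k then pred a else a
raise k a = if k then suc a else a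

lower≤ : ∀ k a → lower k a ≤ a
lower≤ false a = ≤-refl
lower≤ true  a = pred[n]≤n

-- One arc, with tail cut value a and head cut value b. The horizon test t + τ ≤ T of crosses is
-- left out; it is implied once b ≤ T + 1 (crossing-within-horizon).
module EdgeCut (τ T : ℕ) (u : ℕ → ℚ) where

  Steady : ℕ → Set
  Steady x = u x ≡ u (suc x)

  crossing : ℕ → ℕ → ℕ → Bool
  crossing a b t = (a ≤ᵇ t) ∧ (t + τ <ᵇ b)

  cost : ℕ → ℕ → ℚ
  cost a b = sumBelow (suc T) λ t → if crossing a b t then u t else 0ℚ

  departing : ℕ → ℕ → ℚ
  departing a b = if a + τ <ᵇ b then u a else 0ℚ

  arriving : ℕ → ℕ → ℚ
  arriving a b = if a + τ ≤ᵇ b then u (b ∸ τ) else 0ℚ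

  crossing-within-horizon : ∀ {a b} t → b ≤ suc T → ((t + τ ≤ᵇ T) ∧ crossing a b t) ≡ crossing a b t
  crossing-within-horizon {a} {b} t b≤1+T with t + τ <? b
  ... | yes t+τ<b rewrite <ᵇ-true t+τ<b | ≤ᵇ-true (≤-pred (≤-trans t+τ<b b≤1+T)) = refl
  ... | no  t+τ≮b rewrite <ᵇ-false t+τ≮b | ∧-zeroʳ (a ≤ᵇ t) | ∧-zeroʳ (t + τ ≤ᵇ T) = refl

  cost-sucˡ : ∀ {a} b → a ≤ T → cost a b ≡ cost (suc a) b ℚ.+ departing a b
  cost-sucˡ {a} b a≤T = begin
    cost a b
      ≡⟨ sumBelow-cong (suc T) split ⟩
    sumBelow (suc T) (λ t → (if crossing (suc a) b t then u t else 0ℚ) ℚ.+ point a (departing a b) t)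
      ≡⟨ sumBelow-+ (suc T) _ _ ⟩
    cost (suc a) b ℚ.+ sumBelow (suc T) (point a (departing a b))
      ≡⟨ cong (cost (suc a) b ℚ.+_) (sumBelow-point _ (s≤s a≤T)) ⟩
    cost (suc a) b ℚ.+ departing a b ∎
    where
    open ≡-Reasoning
    split : ∀ t → (if crossing a b t then u t else 0ℚ) ≡
                  (if crossing (suc a) b t then u t else 0ℚ) ℚ.+ point a (departing a b) t
    split t with t ≟ a
    ... | yes refl rewrite ≤ᵇ-true (≤-refl {t}) | <ᵇ-false (<-irrefl {t} refl) =
      sym (trans (cong (0ℚ ℚ.+_) (point-on t _)) (ℚₚ.+-identityˡ _))
    ... | no t≢a rewrite ≤ᵇ-cong {a} {t} {suc a} {t} (≤⇔<-if-≢ (t≢a ∘ sym)) =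
      sym (trans (cong ((if crossing (suc a) b t then u t else 0ℚ) ℚ.+_) (point-off (departing a b) t≢a))
                 (ℚₚ.+-identityʳ _))

  arriving-on : ∀ a t → point (t + τ ∸ τ) (arriving a (t + τ)) t ≡ (if a ≤ᵇ t then u t else 0ℚ)
  arriving-on a t rewrite m+n∸n≡m t τ =
    trans (point-on t _) (if-cong (≤ᵇ-cong (mk⇔ (+-cancelʳ-≤ τ a t) (+-monoˡ-≤ τ))) (λ _ → refl))

  arriving-off : ∀ a {b t} → t + τ ≢ b → point (b ∸ τ) (arriving a b) t ≡ 0ℚ
  arriving-off a {b} {t} t+τ≢b with t ≟ b ∸ τ
  ... | no t≢b∸τ = point-off _ t≢b∸τ
  ... | yes refl =
    trans (point-on (b ∸ τ) (arriving a b)) (cong (λ c → if c then u (b ∸ τ) else 0ℚ) (≤ᵇ-false a+τ≰b))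
    where
    a+τ≰b : ¬ a + τ ≤ b
    a+τ≰b a+τ≤b = t+τ≢b (m∸n+n≡m (≤-trans (m≤n+m τ a) a+τ≤b))

  cost-sucʳ : ∀ a {b} → b ≤ T → cost a (suc b) ≡ cost a b ℚ.+ arriving a b
  cost-sucʳ a {b} b≤T = begin
    cost a (suc b)
      ≡⟨ sumBelow-cong (suc T) split ⟩
    sumBelow (suc T) (λ t → (if crossing a b t then u t else 0ℚ) ℚ.+ point (b ∸ τ) (arriving a b) t)
      ≡⟨ sumBelow-+ (suc T) _ _ ⟩
    cost a b ℚ.+ sumBelow (suc T) (point (b ∸ τ) (arriving a b))
      ≡⟨ cong (cost a b ℚ.+_) (sumBelow-point _ (s≤s (≤-trans (m∸n≤m b τ) b≤T))) ⟩
    cost a b ℚ.+ arriving a b ∎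
    where
    open ≡-Reasoning
    split : ∀ t → (if crossing a (suc b) t then u t else 0ℚ) ≡
                  (if crossing a b t then u t else 0ℚ) ℚ.+ point (b ∸ τ) (arriving a b) t
    split t with t + τ ≟ b
    ... | yes refl rewrite <ᵇ-true (n<1+n (t + τ)) | <ᵇ-false (<-irrefl {t + τ} refl)
                         | ∧-identityʳ (a ≤ᵇ t) | ∧-zeroʳ (a ≤ᵇ t) =
      sym (trans (ℚₚ.+-identityˡ _) (arriving-on a t))
    ... | no t+τ≢b =
      trans (cong (λ c → if (a ≤ᵇ t) ∧ c then u t else 0ℚ) (≤ᵇ-cong (<-suc⇔<-if-≢ t+τ≢b)))
            (sym (trans (cong ((if crossing a b t then u t else 0ℚ) ℚ.+_) (arriving-off a t+τ≢b))
                        (ℚₚ.+-identityʳ _)))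

  arrival-steady : ∀ {a b} → (∀ e → b ≡ e + τ → Steady e) → (a + τ ≤ᵇ b) ≡ true → u (b ∸ τ) ≡ u (suc b ∸ τ)
  arrival-steady {a} {b} arrivals a+τ≤ᵇb =
    trans (arrivals (b ∸ τ) (sym (m∸n+n≡m τ≤b))) (cong u (sym (+-∸-assoc 1 τ≤b)))
    where
    τ≤b : τ ≤ b
    τ≤b = ≤-trans (m≤n+m τ a) (≤ᵇ-sound a+τ≤ᵇb)

  cost-balancedˡ : ∀ {a} b → suc a ≤ T → Steady a → b ≢ suc a + τ →
                   cost a b ℚ.+ cost (2 + a) b ≡ cost (1 + a) b ℚ.+ cost (1 + a) b
  cost-balancedˡ {a} b 1+a≤T steady b≢1+a+τ =
    progression-midpoint (cost (1 + a) b) (cost (2 + a) b) (departing a b) 0ℚ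
      (cost-sucˡ b (<⇒≤ 1+a≤T))
      (sym (ℚₚ.+-identityʳ _))
      (sym (ℚₚ.+-identityʳ _))
      (trans (cost-sucˡ b 1+a≤T) (cong (cost (2 + a) b ℚ.+_) (sym same-departure)))
    where
    same-departure : departing a b ≡ departing (1 + a) b
    same-departure = if-cong (≤ᵇ-cong (≤⇔<-if-≢ (b≢1+a+τ ∘ sym))) (λ _ → steady)

  cost-balancedʳ : ∀ a {b} → suc b ≤ T → (∀ e → b ≡ e + τ → Steady e) → suc b ≢ a + τ →
                   cost a b ℚ.+ cost a (2 + b) ≡ cost a (1 + b) ℚ.+ cost a (1 + b)
  cost-balancedʳ a {b} 1+b≤T arrivals 1+b≢a+τ =
    progression-midpoint (cost a b) (cost a (1 + b)) 0ℚ (arriving a b)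
      (sym (ℚₚ.+-identityʳ (cost a b)))
      (trans (cost-sucʳ a 1+b≤T) (cong (cost a (1 + b) ℚ.+_) same-arrival))
      (cost-sucʳ a (<⇒≤ 1+b≤T))
      (sym (ℚₚ.+-identityʳ (cost a (1 + b))))
    where
    same-arrival : arriving a (1 + b) ≡ arriving a b
    same-arrival = sym (if-cong (≤ᵇ-cong (mk⇔ m≤n⇒m≤1+n (λ ≤1+b → ≤-pred (≤∧≢⇒< ≤1+b (1+b≢a+τ ∘ sym)))))
                                (arrival-steady {a} arrivals))

  cost-balanced : ∀ {a b} → suc a ≤ T → suc b ≤ T → Steady a → (∀ e → b ≡ e + τ → Steady e) →
                  cost a b ℚ.+ cost (2 + a) (2 + b) ≡ cost (1 + a) (1 + b) ℚ.+ cost (1 + a) (1 + b)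
  cost-balanced {a} {b} 1+a≤T 1+b≤T steady arrivals =
    progression-midpoint (cost (1 + a) b) (cost (2 + a) (1 + b)) (departing a b) (arriving (1 + a) b)
      (cost-sucˡ b (<⇒≤ 1+a≤T))
      (trans (cost-sucʳ (2 + a) 1+b≤T)
             (cong (cost (2 + a) (1 + b) ℚ.+_) (sym (if-cong refl (arrival-steady {suc a} arrivals)))))
      (cost-sucʳ (1 + a) (<⇒≤ 1+b≤T))
      (trans (cost-sucˡ (1 + b) 1+a≤T)
             (cong (cost (2 + a) (1 + b) ℚ.+_) (if-cong {c = a + τ <ᵇ b} refl (λ _ → sym steady))))

  cost-shift-balanced : ∀ k l {a b} →
                        (k ≡ true → Shiftable Steady τ T a) → (l ≡ true → Shiftable Steady τ T b) →
                        (k ≢ l → b ≢ a + τ) →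
                        cost (lower k a) (lower l b) ℚ.+ cost (raise k a) (raise l b) ≡ cost a b ℚ.+ cost a b
  cost-shift-balanced false false _ _ _ = refl
  cost-shift-balanced true false {b = b} shiftˡ _ separated with shiftˡ refl
  ... | shiftable 1+p≤T departures _ = cost-balancedˡ b 1+p≤T departures (separated λ ())
  cost-shift-balanced false true {a} _ shiftʳ separated with shiftʳ refl
  ... | shiftable 1+q≤T _ arrivals = cost-balancedʳ a 1+q≤T arrivals (separated λ ())
  cost-shift-balanced true true shiftˡ shiftʳ _ with shiftˡ refl | shiftʳ refl
  ... | shiftable 1+p≤T departures _ | shiftable 1+q≤T _ arrivals =
    cost-balanced 1+p≤T 1+q≤T departures arrivals

Rung : (τ bottom rungs x : ℕ) → Set
Rung τ bottom rungs x = ∃ λ m → m < rungs × x ≡ bottom + m * τ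

rung? : ∀ τ bottom rungs x → Dec (Rung τ bottom rungs x)
rung? τ bottom rungs x = anyUpTo? (λ m → x ≟ bottom + m * τ) rungs

module _ {n} (φ : Fin n → ℕ) where

  -- The maximal progression of τ-spaced cut values through a, each rung taken by its own node.
  record Ladder (τ a : ℕ) : Set where
    field
      bottom rungs level : ℕ
      rungs≤n     : rungs ≤ n
      level<rungs : level < rungs
      a≡          : a ≡ bottom + level * τ
      step-up     : ∀ {x} j → Rung τ bottom rungs x → φ j ≡ x + τ → Rung τ bottom rungs (φ j)
      step-down   : ∀ {x} j → Rung τ bottom rungs x → x ≡ φ j + τ → Rung τ bottom rungs (φ j)

  flatLadder : ∀ i → Ladder 0 (φ i)
  flatLadder i = record
    { bottom = φ i ; rungs = 1 ; level = 0
    ; rungs≤n = ≤-trans (s≤s z≤n) (toℕ<n i) ; level<rungs = ≤-refl ; a≡ = sym (+-identityʳ (φ i))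
    ; step-up = λ j rung φj≡x+0 → stay rung (trans φj≡x+0 (+-identityʳ _))
    ; step-down = λ j rung x≡φj+0 → stay rung (sym (trans x≡φj+0 (+-identityʳ _)))
    }
    where
    stay : ∀ {x y} → Rung 0 (φ i) 1 x → y ≡ x → Rung 0 (φ i) 1 y
    stay (m , m<1 , x≡) y≡x = m , m<1 , trans y≡x x≡

  module SteppedLadder (τ : ℕ) .{{_ : NonZero τ}} (B : ℕ) (φ≤B : ∀ k → φ k ≤ B) (i : Fin n) where
    open ≡-Reasoning

    Down : ℕ → Set
    Down m = ∃ λ j → φ j + m * τ ≡ φ i

    downRun : ∃ λ r → (∀ {m} → m < r → Down (suc m)) × ¬ Down (suc r)
    downRun = leastFailure (λ m → any? λ j → φ j + suc m * τ ≟ φ i) (φ i) tooLow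
      where
      tooLow : ¬ Down (suc (φ i))
      tooLow (j , eq) = 1+n≰n (≤-trans (≤-trans (m≤m*n (suc (φ i)) τ) (m≤n+m _ (φ j))) (≤-reflexive eq))

    level : ℕ
    level = proj₁ downRun

    down : ∀ {m} → m ≤ level → Down m
    down {zero}  _         = i , +-identityʳ (φ i)
    down {suc m} 1+m≤level = proj₁ (proj₂ downRun) 1+m≤level

    bottom : ℕ
    bottom = φ (proj₁ (down (≤-refl {level})))

    bottom+level : bottom + level * τ ≡ φ i
    bottom+level = proj₂ (down ≤-refl)

    Up : ℕ → Set
    Up m = ∃ λ j → φ j ≡ bottom + m * τ

    upRun : ∃ λ r → (∀ {m} → m < r → Up m) × ¬ Up r
    upRun = leastFailure (λ m → any? λ j → φ j ≟ bottom + m * τ) (suc B) tooHigh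
      where
      tooHigh : ¬ Up (suc B)
      tooHigh (j , eq) =
        1+n≰n (≤-trans (≤-trans (m≤m*n (suc B) τ) (m≤n+m _ bottom)) (≤-trans (≤-reflexive (sym eq)) (φ≤B j)))

    rungs : ℕ
    rungs = proj₁ upRun

    up : ∀ {m} → m < rungs → Up m
    up = proj₁ (proj₂ upRun)

    up-from-down : ∀ {m} → m ≤ level → Up m
    up-from-down {m} m≤level with down (m∸n≤m level m)
    ... | j , eq = j , +-cancelʳ-≡ ((level ∸ m) * τ) (φ j) (bottom + m * τ) (begin
      φ j + (level ∸ m) * τ             ≡⟨ eq ⟩
      φ i                               ≡⟨ sym bottom+level ⟩
      bottom + level * τ                ≡⟨ cong (λ l → bottom + l * τ) (sym (m+[n∸m]≡n m≤level)) ⟩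
      bottom + (m + (level ∸ m)) * τ    ≡⟨ x+[m+k]τ≡x+mτ+kτ bottom m (level ∸ m) τ ⟩
      bottom + m * τ + (level ∸ m) * τ  ∎)

    rungs≤n : rungs ≤ n
    rungs≤n = injective⇒≤ {f = node} node-injective
      where
      node : Fin rungs → Fin n
      node m = proj₁ (up (toℕ<n m))
      node-injective : ∀ {x y} → node x ≡ node y → x ≡ y
      node-injective {x} {y} eq = toℕ-injective (*-cancelʳ-≡ (toℕ x) (toℕ y) τ (+-cancelˡ-≡ bottom _ _
        (trans (sym (proj₂ (up (toℕ<n x)))) (trans (cong φ eq) (proj₂ (up (toℕ<n y)))))))

    step-up : ∀ {x} j → Rung τ bottom rungs x → φ j ≡ x + τ → Rung τ bottom rungs (φ j)
    step-up j (m , m<rungs , x≡) φj≡x+τ =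
      suc m , ≤∧≢⇒< m<rungs (λ 1+m≡rungs → proj₂ (proj₂ upRun) (subst Up 1+m≡rungs (j , φj≡))) , φj≡
      where
      φj≡ : φ j ≡ bottom + suc m * τ
      φj≡ = trans φj≡x+τ (trans (cong (_+ τ) x≡) (sym (x+[1+m]τ≡x+mτ+τ bottom m τ)))

    step-down : ∀ {x} j → Rung τ bottom rungs x → x ≡ φ j + τ → Rung τ bottom rungs (φ j)
    step-down j (zero , _ , x≡) x≡φj+τ = contradiction (j , eq) (proj₂ (proj₂ downRun))
      where
      eq : φ j + suc level * τ ≡ φ i
      eq = begin
        φ j + (τ + level * τ)  ≡⟨ +-assoc (φ j) τ (level * τ) ⟨
        φ j + τ + level * τ    ≡⟨ cong (_+ level * τ) (trans (sym x≡φj+τ) (trans x≡ (+-identityʳ bottom))) ⟩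
        bottom + level * τ     ≡⟨ bottom+level ⟩
        φ i                    ∎
    step-down j (suc m , 1+m<rungs , x≡) x≡φj+τ =
      m , <-trans (n<1+n m) 1+m<rungs ,
      +-cancelʳ-≡ τ (φ j) (bottom + m * τ) (trans (sym x≡φj+τ) (trans x≡ (x+[1+m]τ≡x+mτ+τ bottom m τ)))

    ladder : Ladder τ (φ i)
    ladder = record
      { bottom = bottom ; rungs = rungs ; level = level
      ; rungs≤n = rungs≤n
      ; level<rungs = ≰⇒> λ rungs≤level → proj₂ (proj₂ upRun) (up-from-down rungs≤level)
      ; a≡ = sym bottom+level
      ; step-up = step-up
      ; step-down = step-down
      }

  ladder : ∀ τ {B} → (∀ k → φ k ≤ B) → ∀ i → Ladder τ (φ i)
  ladder zero    _   i = flatLadder i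
  ladder τ@(suc _) φ≤B i = SteppedLadder.ladder τ _ φ≤B i

module Network {n} (N : TemporalNetwork n) (T : ℕ) where

  Steady : ℕ → Set
  Steady x = ∀ i j → E N i j ≡ true → u N i j x ≡ u N i j (suc x)

  Changes : ℕ → Set
  Changes x = Σ (Fin n) λ i → Σ (Fin n) λ j → (E N i j ≡ true) × ¬ (u N i j x ≡ u N i j (suc x))

  steady⊎changes : ∀ x → Steady x ⊎ Changes x
  steady⊎changes x with any? (λ i → any? λ j → (E N i j Boolₚ.≟ true) ×-dec ¬? (u N i j x ℚₚ.≟ u N i j (suc x)))
  ... | yes changes = inj₂ changes
  ... | no ¬changes = inj₁ λ i j edge →
    decidable-stable (u N i j x ℚₚ.≟ u N i j (suc x)) (λ u≢ → ¬changes (i , j , edge , u≢))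

  change-time : ∀ {x} → suc x ≤ T → Changes x → InChangeTimes N T (suc x)
  change-time {x} 1+x≤T changes = inj₂ (inj₂ (inj₂ (x , refl , 1+x≤T , changes)))

  NearCritical : ℕ → Set
  NearCritical c = ∃ λ θ → ∃ λ ℓ → ℓ ≤ 1 × c ≡ θ + ℓ * τ N × InChangeTimes N T θ

  critical⇒near : ∀ {c} → InChangeTimes N T c → NearCritical c
  critical⇒near {c} c∈𝒯 = c , 0 , z≤n , sym (+-identityʳ c) , c∈𝒯

  ShiftableCut : ℕ → Set
  ShiftableCut = Shiftable Steady (τ N) T

  arrivals-steady⊎near : ∀ {p} → suc p ≤ T → (∀ e → p ≡ e + τ N → Steady e) ⊎ NearCritical (suc p)
  arrivals-steady⊎near {p} 1+p≤T with τ N ≤? p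
  ... | no τ≰p = inj₁ λ e p≡e+τ → contradiction (subst (τ N ≤_) (sym p≡e+τ) (m≤n+m (τ N) e)) τ≰p
  ... | yes τ≤p with steady⊎changes (p ∸ τ N)
  ...   | inj₁ steady = inj₁ λ e p≡e+τ → subst Steady (trans (cong (_∸ τ N) p≡e+τ) (m+n∸n≡m e (τ N))) steady
  ...   | inj₂ changes = inj₂ (suc (p ∸ τ N) , 1 , ≤-refl ,
            cong suc (sym (trans (cong (p ∸ τ N +_) (*-identityˡ (τ N))) (m∸n+n≡m τ≤p))) ,
            change-time (≤-trans (s≤s (m∸n≤m p (τ N))) 1+p≤T) changes)

  near⊎shiftable : ∀ c → c ≤ suc T → NearCritical c ⊎ ShiftableCut c
  near⊎shiftable zero    _      = inj₁ (critical⇒near (inj₁ refl))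
  near⊎shiftable (suc p) c≤1+T with m≤n⇒m<n∨m≡n c≤1+T
  ... | inj₂ c≡1+T = inj₁ (critical⇒near (inj₂ (inj₂ (inj₁ c≡1+T))))
  ... | inj₁ (s≤s 1+p≤T) with steady⊎changes p | arrivals-steady⊎near 1+p≤T
  ...   | inj₂ changes   | _             = inj₁ (critical⇒near (change-time 1+p≤T changes))
  ...   | inj₁ _         | inj₂ near     = inj₁ near
  ...   | inj₁ departures | inj₁ arrivals = inj₂ (shiftable 1+p≤T departures arrivals)

  progression-critical : ∀ {a c bottom p q r} → p < r → q < r → r ≤ n →
                         a ≡ bottom + p * τ N → c ≡ bottom + q * τ N → NearCritical c → InCritN N T a
  progression-critical {a} {c} {bottom} {p} {q} p<r q<r r≤n a≡ c≡ (θ , ℓ , ℓ≤1 , c≡θ+ℓτ , θ∈𝒯)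
    with cancel-multiples a θ q (ℓ + p) (τ N)
           (progression-shift {bottom = bottom} {p} {q} {θ} {ℓ} {τ N} a≡ c≡ c≡θ+ℓτ)
  ... | inj₁ (d , d≤q , a+dτ≡θ)   = θ , d , θ∈𝒯 , ≤-trans d≤q (<⇒≤ (<-≤-trans q<r r≤n)) , inj₂ a+dτ≡θ
  ... | inj₂ (d , d≤ℓ+p , a≡θ+dτ) =
    θ , d , θ∈𝒯 , ≤-trans d≤ℓ+p (≤-trans (+-monoˡ-≤ p ℓ≤1) (≤-trans p<r r≤n)) , inj₁ a≡θ+dτ

  module Edge (i j : Fin n) = EdgeCut (τ N) T (u N i j)

  edgeCost : Fin n → Fin n → ℕ → ℕ → ℚ
  edgeCost i j a b = if E N i j ∧ not ⌊ i Fin.≟ j ⌋ then Edge.cost i j a b else 0ℚ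

  cutCost-edgeCosts : ∀ φ → (∀ k → φ k ≤ suc T) →
                      cutCost N T φ ≡ sumFin n λ i → sumFin n λ j → edgeCost i j (φ i) (φ j)
  cutCost-edgeCosts φ φ≤ = sumFin-cong n λ i → sumFin-cong n λ j → edge i j {φ i} (φ≤ j)
    where
    edge : ∀ i j {a b} → b ≤ suc T →
           sumBelow (suc T) (λ t → if E N i j ∧ not ⌊ i Fin.≟ j ⌋ ∧ (t + τ N ≤ᵇ T) ∧ Edge.crossing i j a b t
                                   then u N i j t else 0ℚ)
           ≡ edgeCost i j a b
    edge i j {a} b≤1+T with E N i j | not ⌊ i Fin.≟ j ⌋
    ... | false | _     = sumBelow-zero (suc T)
    ... | true  | false = sumBelow-zero (suc T)
    ... | true  | true  = sumBelow-cong (suc T) λ t →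
      cong (λ c → if c then u N i j t else 0ℚ) (Edge.crossing-within-horizon i j {a} t b≤1+T)

  cutCost-cong : ∀ {φ ψ} → (∀ k → φ k ≡ ψ k) → cutCost N T φ ≡ cutCost N T ψ
  cutCost-cong φ≗ψ = sumFin-cong n λ i → sumFin-cong n λ j → sumBelow-cong (suc T) λ t →
    cong₂ (λ a b → if E N i j ∧ not ⌊ i Fin.≟ j ⌋ ∧ (t + τ N ≤ᵇ T) ∧ Edge.crossing i j a b t
                   then u N i j t else 0ℚ)
          (φ≗ψ i) (φ≗ψ j)

  edgeCost-shift-balanced : ∀ i j k l {a b} → (k ≡ true → ShiftableCut a) → (l ≡ true → ShiftableCut b) →
                            (k ≢ l → b ≢ a + τ N) →
                            edgeCost i j (lower k a) (lower l b) ℚ.+ edgeCost i j (raise k a) (raise l b)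
                            ≡ edgeCost i j a b ℚ.+ edgeCost i j a b
  edgeCost-shift-balanced i j k l shiftˡ shiftʳ separated with E N i j in edge | not ⌊ i Fin.≟ j ⌋
  ... | false | _     = refl
  ... | true  | false = refl
  ... | true  | true  = Edge.cost-shift-balanced i j k l (onEdge ∘ shiftˡ) (onEdge ∘ shiftʳ) separated
    where
    onEdge : ∀ {c} → ShiftableCut c → Shiftable (Edge.Steady i j) (τ N) T c
    onEdge = Shiftable-map λ steady → steady i j edge

  Separated : (Fin n → Bool) → (Fin n → ℕ) → Set
  Separated K φ = ∀ i j → K i ≢ K j → φ j ≢ φ i + τ N

  ShiftableOn : (Fin n → Bool) → (Fin n → ℕ) → Set
  ShiftableOn K φ = ∀ k → K k ≡ true → ShiftableCut (φ k)

  lowerOn raiseOn : (Fin n → Bool) → (Fin n → ℕ) → Fin n → ℕ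
  lowerOn K φ k = lower (K k) (φ k)
  raiseOn K φ k = raise (K k) (φ k)

  raiseOn-≤ : ∀ {K φ} → (∀ k → φ k ≤ suc T) → ShiftableOn K φ → ∀ k → raiseOn K φ k ≤ suc T
  raiseOn-≤ {K} φ≤ shift k with K k in Kk
  ... | false = φ≤ k
  ... | true  = s≤s (Shiftable⇒≤ (shift k Kk))

  cutCost-shift-balanced : ∀ {K φ} → (∀ k → φ k ≤ suc T) → ShiftableOn K φ → Separated K φ →
                           cutCost N T (lowerOn K φ) ℚ.+ cutCost N T (raiseOn K φ)
                           ≡ cutCost N T φ ℚ.+ cutCost N T φ
  cutCost-shift-balanced {K} {φ} φ≤ shift separated =
    trans (cong₂ ℚ._+_ (cutCost-edgeCosts _ λ k → ≤-trans (lower≤ (K k) (φ k)) (φ≤ k))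
                       (cutCost-edgeCosts _ (raiseOn-≤ φ≤ shift)))
    (trans (sumFin-balanced n λ i → sumFin-balanced n λ j →
              edgeCost-shift-balanced i j (K i) (K j) (shift i) (shift j) (separated i j))
           (sym (cong₂ ℚ._+_ (cutCost-edgeCosts φ φ≤) (cutCost-edgeCosts φ φ≤))))

  module Endpoints (s d : Fin n) where

    MinCut : (Fin n → ℕ) → Set
    MinCut = IsMinCutFunction N T s d

    pin : Fin n → ℕ → ℕ
    pin k x = if does (k Fin.≟ s) then 0 else if does (k Fin.≟ d) then suc T else x

    pin-source : ∀ x → pin s x ≡ 0
    pin-source x =
      cong (λ b → if b then 0 else if does (s Fin.≟ d) then suc T else x) (dec-true (s Fin.≟ s) refl)

    pin-sink : s ≢ d → ∀ x → pin d x ≡ suc T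
    pin-sink s≢d x =
      trans (cong (λ b → if b then 0 else if does (d Fin.≟ d) then suc T else x)
                  (dec-false (d Fin.≟ s) (s≢d ∘ sym)))
            (cong (λ b → if b then suc T else x) (dec-true (d Fin.≟ d) refl))

    pin-cut : s ≢ d → ∀ {φ : Fin n → ℕ} → (∀ k → φ k ≤ suc T) → IsCutFunction T s d (λ k → pin k (φ k))
    pin-cut s≢d {φ} φ≤ =
      (λ k → if-≤ (does (k Fin.≟ s)) z≤n (if-≤ (does (k Fin.≟ d)) ≤-refl (φ≤ k))) ,
      pin-source (φ s) , pin-sink s≢d (φ d)

    pin-id : ∀ {ψ} → IsCutFunction T s d ψ → ∀ k → pin k (ψ k) ≡ ψ k
    pin-id {ψ} (_ , ψs≡0 , ψd≡1+T) k with k Fin.≟ s | k Fin.≟ d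
    ... | yes refl | _        = sym ψs≡0
    ... | no _     | yes refl = sym ψd≡1+T
    ... | no _     | no _     = refl

    minCut-exists : s ≢ d → ∃ MinCut
    minCut-exists s≢d
      with Minimiser.argmin ℚₚ.≤-totalPreorder n (suc T) (λ φ → cutCost N T λ k → pin k (φ k))
             (λ φ≗ψ → cutCost-cong λ k → cong (pin k) (φ≗ψ k))
    ... | φ , φ≤ , minimal = (λ k → pin k (φ k)) , pin-cut s≢d φ≤ , λ ψ cutψ →
      ℚₚ.≤-trans (minimal ψ (proj₁ cutψ)) (ℚₚ.≤-reflexive (cutCost-cong (pin-id {ψ} cutψ)))

    shifted-cuts : ∀ {K φ} → IsCutFunction T s d φ → ShiftableOn K φ →
                   IsCutFunction T s d (lowerOn K φ) × IsCutFunction T s d (raiseOn K φ)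
    shifted-cuts {K} {φ} (φ≤ , φs≡0 , φd≡1+T) shift =
      ((λ k → ≤-trans (lower≤ (K k) (φ k)) (φ≤ k)) , proj₁ (fixed s Ks φs≡0) , proj₁ (fixed d Kd φd≡1+T)) ,
      (raiseOn-≤ φ≤ shift , proj₂ (fixed s Ks φs≡0) , proj₂ (fixed d Kd φd≡1+T))
      where
      unshifted : ∀ k → ¬ ShiftableCut (φ k) → K k ≡ false
      unshifted k ¬shiftable with K k in Kk
      ... | false = refl
      ... | true  = contradiction (shift k Kk) ¬shiftable
      Ks : K s ≡ false
      Ks = unshifted s λ shiftable-s → ¬shiftable-0 (subst ShiftableCut φs≡0 shiftable-s)
        where
        ¬shiftable-0 : ¬ ShiftableCut 0
        ¬shiftable-0 ()
      Kd : K d ≡ false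
      Kd = unshifted d λ shiftable-d → 1+n≰n (Shiftable⇒≤ (subst ShiftableCut φd≡1+T shiftable-d))
      fixed : ∀ k {c} → K k ≡ false → φ k ≡ c → lowerOn K φ k ≡ c × raiseOn K φ k ≡ c
      fixed k Kk≡false φk≡c rewrite Kk≡false = φk≡c , φk≡c

    lowerOn-minCut : ∀ {K φ} → MinCut φ → ShiftableOn K φ → Separated K φ → MinCut (lowerOn K φ)
    lowerOn-minCut {K} {φ} (cut , minimal) shift separated =
      proj₁ (shifted-cuts cut shift) , λ ψ cutψ → ℚₚ.≤-trans cost≤ (minimal ψ cutψ)
      where
      cost≤ : cutCost N T (lowerOn K φ) ℚ.≤ cutCost N T φ
      cost≤ = balanced⇒≤ (cutCost-shift-balanced (proj₁ cut) shift separated)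
                         (minimal _ (proj₂ (shifted-cuts cut shift)))

    SmallerMinCut : (Fin n → ℕ) → Set
    SmallerMinCut φ = ∃ λ φ′ → MinCut φ′ × sumℕ φ′ < sumℕ φ

    module AtNode {φ} (minCut : MinCut φ) {i} (L : Ladder φ (τ N) (φ i)) where
      open Ladder L

      OnLadder : Fin n → Set
      OnLadder k = Rung (τ N) bottom rungs (φ k)

      K : Fin n → Bool
      K k = does (rung? (τ N) bottom rungs (φ k))

      K-sound : ∀ k → K k ≡ true → OnLadder k
      K-sound k with rung? (τ N) bottom rungs (φ k)
      ... | yes onLadder = λ _ → onLadder
      ... | no _         = λ ()

      separated : Separated K φ
      separated k l with rung? (τ N) bottom rungs (φ k) | rung? (τ N) bottom rungs (φ l)
      ... | yes onˡ | no ¬onʳ = λ _ φl≡φk+τ → ¬onʳ (step-up l onˡ φl≡φk+τ)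
      ... | no ¬onˡ | yes onʳ = λ _ φl≡φk+τ → ¬onˡ (step-down k onʳ φl≡φk+τ)
      ... | yes _   | yes _   = λ K≢K _ → K≢K refl
      ... | no _    | no _    = λ K≢K _ → K≢K refl

      classify : ∀ k → (OnLadder k → ShiftableCut (φ k)) ⊎ (∃ λ k → OnLadder k × NearCritical (φ k))
      classify k with rung? (τ N) bottom rungs (φ k)
      ... | no ¬onLadder = inj₁ λ onLadder → contradiction onLadder ¬onLadder
      ... | yes onLadder with near⊎shiftable (φ k) (proj₁ (proj₁ minCut) k)
      ...   | inj₁ near      = inj₂ (k , onLadder , near)
      ...   | inj₂ shiftableφk = inj₁ λ _ → shiftableφk

      critical-or-smaller : InCritN N T (φ i) ⊎ SmallerMinCut φ
      critical-or-smaller with ∀⊎-const classify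
      ... | inj₂ (k , (m , m<rungs , φk≡) , near) =
        inj₁ (progression-critical level<rungs m<rungs rungs≤n a≡ φk≡ near)
      ... | inj₁ shiftable-rungs =
        inj₂ (lowerOn K φ , lowerOn-minCut minCut shift separated ,
              sumℕ-mono-< (λ k → lower≤ (K k) (φ k)) i lowered)
        where
        shift : ShiftableOn K φ
        shift k = shiftable-rungs k ∘ K-sound k
        Ki : K i ≡ true
        Ki = dec-true (rung? (τ N) bottom rungs (φ i)) (level , level<rungs , a≡)
        lowered : lowerOn K φ i < φ i
        lowered = subst (λ b → lower b (φ i) < φ i) (sym Ki) (Shiftable⇒pred< (shift i Ki))

    descend : ∀ φ → Acc _<_ (sumℕ φ) → MinCut φ → ∃ λ φ → MinCut φ × CritSubset N T φ
    descend φ (acc smaller) minCut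
      with ∀⊎-const (λ i → AtNode.critical-or-smaller minCut (ladder φ (τ N) (proj₁ (proj₁ minCut)) i))
    ... | inj₁ critical                = φ , minCut , critical
    ... | inj₂ (φ′ , minCut′ , φ′<φ) = descend φ′ (smaller φ′<φ) minCut′

lemma2 : (n : ℕ) (N : TemporalNetwork n) (s d : Fin n) → ¬ (s ≡ d) → (T : ℕ) →
         Σ (Fin n → ℕ) λ φ → IsMinCutFunction N T s d φ × CritSubset N T φ
lemma2 n N s d s≢d T =
  let φ₀ , minCut₀ = minCut-exists s≢d in descend φ₀ (<-wellFounded (sumℕ φ₀)) minCut₀
  where
  open Network N T
  open Endpoints s d
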